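{- Let $t\ge3$ and let $\mathcal C\subseteq\{0,1\}^n$ be a (binary) $t$-frameproof code of size $m$. Then \[ m\le \binom{n}{\left\lceil \frac{n-t+1}{\binom{t}{2}}\right\rceil}+t. \]
   Context: For a nonempty set $X=\{\mathbf c^1,\dots,\mathbf c^s\}\subseteq\{0,1\}^n$, let $\mathrm{desc}(X)=\{\mathbf y\in\{0,1\}^n: y_i\in\{c^1_i,\dots,c^s_i\}\text{ for all } i\in[n]\}$. A code $\mathcal C\subseteq\{0,1\}^n$ is a $t$-frameproof code if $\mathrm{desc}(X)\cap\mathcal C=X$ for every nonempty $X\subseteq\mathcal C$ with $|X|\le t$. Binomial coefficients with negative lower index are $0$. -}

module Defs where

open import Data.Bool using (Bool)
open import Data.Nat using (ℕ; zero; suc; _+_; _∸_; _/_; NonZero; _≤_)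
open import Data.Nat.Combinatorics using (_C_)
open import Data.Integer using (ℤ; +_; -[1+_]; _-_)
open import Data.Fin using (Fin)
open import Data.Vec using (Vec; lookup)
open import Data.List using (List; length)
open import Data.List.Membership.Propositional using (_∈_)
open import Data.List.Relation.Unary.Unique.Propositional using (Unique)
open import Data.Product using (∃; _×_)
open import Relation.Binary.PropositionalEquality using (_≡_)

Word : ℕ → Set
Word n = Vec Bool n

_∈desc_ : ∀ {n} → Word n → List (Word n) → Set
y ∈desc X = ∀ i → ∃ λ c → c ∈ X × lookup y i ≡ lookup c i

-- A code is a duplicate-free list of words (a finite set).  Subsets X are given as lists of
-- elements of C; repetitions are harmless since desc(X) depends only on the
-- underlying set, and a set of size ≤ t is a list of length ≤ t.
IsFrameproof : ∀ {n} → ℕ → List (Word n) → Set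
IsFrameproof {n} t C =
  (X : List (Word n)) → (∀ {x} → x ∈ X → x ∈ C) → 1 ≤ length X → length X ≤ t →
  (y : Word n) → y ∈ C → y ∈desc X → y ∈ X

binomℤ : ℕ → ℤ → ℕ
binomℤ n (+ k)    = n C k
binomℤ n -[1+ k ] = 0

-- Ceiling of a / b for an integer a and a natural b > 0
-- (the value for b = 0 is an irrelevant junk value 0; it is only used with b = C(t,2) ≥ 3).
ceilDiv : ℤ → ℕ → ℤ
ceilDiv a        zero    = + 0
ceilDiv (+ a)    (suc b) = + ((a + b) / suc b)
ceilDiv -[1+ a ] (suc b) with (suc a) / suc b
... | zero  = + 0
... | suc q = -[1+ q ]

{-# OPTIONS --safe #-}
-- Fix a codeword c and replace every other codeword x by the set c Δ x of coordinates
-- where x differs from c.  If one of these sets were covered by t − 1 others, then x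
-- would be a descendant of c and the corresponding t − 1 codewords; so the family is
-- (t − 1)-cover-free.  A member owning a subset of size ≤ k that lies in no other member
-- is charged to that subset; the subsets so chosen are pairwise incomparable, hence by
-- the LYM inequality there are at most C(n,k) of them when 2k ≤ n.  A member owning no
-- such subset has every set of ≤ i·k of its points covered by i other members, one per
-- k points.  So among t such members B₁, …, Bₜ, each Bⱼ has more than (j − 1)·k points
-- outside the union of the later ones (else it is covered by t − 1 others), and together
-- they cover at least C(t,2)·k + t > n points.  Hence at most t − 1 members own nothing,
-- and |𝒞| ≤ 1 + C(n,k) + (t − 1) for k = ⌈(n − t + 1)/C(t,2)⌉.
module Submission where

open import Defs
open import Algebra.Properties.CommutativeSemigroup using (x∙yz≈y∙xz; x∙yz≈yx∙z)
open import Data.Bool using (true; false; not; _xor_; if_then_else_)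
open import Data.Bool.Properties using (¬-not; not-involutive; xor-inverseˡ; xor-comm) renaming (_≟_ to _≟ᵇ_)
open import Data.Empty using (⊥-elim)
open import Data.Fin using (Fin)
import Data.Fin as Fin
open import Data.Fin.Subset using (Subset; inside; outside; _∈_; _⊆_; _⊈_; _∪_; _─_; ⋃; ⊥; ⊤; ∣_∣)
open import Data.Fin.Subset.Properties
  using ( ∉⊥; x∈p∪q⁺; x∈p∪q⁻; ∣⊥∣≡0; ⊆-refl; ⊆-trans; ⊆⊤; _⊆?_; _∈?_; p─q⊆p; x∈p∧x∉q⇒x∈p─q
        ; x∈p⇒∣p-x∣<∣p∣; ∣p∣≤n; ∣p∣≡n⇒p≡⊤; anySubset?)
open import Data.Integer using (+_; -_; -[1+_]; _⊖_; _-_) renaming (_+_ to _+ℤ_)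
open import Data.Integer.Properties using ([+m]-[+n]≡m⊖n; distribˡ-⊖-+-pos; ⊖-≥; ⊖-<)
open import Data.List using (List; []; _∷_; length; map; _++_; take; filter)
open import Data.List.Properties using (map-cong-local; length-map; length-++; length-take)
open import Data.List.Membership.Propositional using (mapWith∈; find) renaming (_∈_ to _∈ₗ_)
open import Data.List.Membership.Propositional.Properties using (∈-filter⁻; ∈-map⁻; ∈-map⁺)
open import Data.List.Membership.Setoid.Properties using (length-mapWith∈)
open import Data.List.Relation.Unary.All as All using (All; []; _∷_)
import Data.List.Relation.Unary.All.Properties as Allₚ
open import Data.List.Relation.Unary.AllPairs as AllPairs using (AllPairs; []; _∷_)
open import Data.List.Relation.Unary.Any using (Any; here; there)
import Data.List.Relation.Unary.Any.Properties as Anyₚ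
open import Data.List.Relation.Unary.Unique.Propositional using (Unique)
import Data.List.Relation.Unary.Unique.Propositional.Properties as Uniqueₚ
open import Data.Nat
  using (ℕ; zero; suc; _+_; _*_; _∸_; _≤_; _<_; _≤?_; _<?_; _≤′_; ≤′-refl; ≤′-step; z≤n; s≤s; _!; NonZero; >-nonZero)
open import Data.Nat.Combinatorics using (_C_; k![n∸k]!∣n!; nCk+nC[k+1]≡[n+1]C[k+1]; nC1≡n)
open import Data.Nat.Combinatorics.Specification using (nCk≡n!/k![n-k]!)
open import Data.Nat.Divisibility using (∣⇒≤)
open import Data.Nat.DivMod using (_/_; _%_; m≡m%n+[m/n]*n; m%n<n; m/n*n≤m; m/n*n≡m; m<n⇒m/n≡0)
open import Data.Nat.ListAction using (sum)
open import Data.Nat.Properties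
open import Algebra.Properties.Semiring.Sum +-*-semiring using (sum-syntax; ∑-distrib-+; sum-replicate-zero; sum-cong-≗)
open import Data.Nat.Solver using (module +-*-Solver)
open import Data.Product using (∃; _×_; _,_; proj₁; proj₂)
open import Data.Sum as Sum using (_⊎_; inj₁; inj₂; [_,_]′)
open import Data.Vec using ([]; _∷_; here; there; lookup; zipWith; removeAt)
open import Data.Vec.Properties using (lookup-zipWith; lookup⇒[]=; []=⇒lookup; removeAt-punchOut; ≡-dec)
open import Function using (_∘_)
open import Relation.Binary.PropositionalEquality
open import Relation.Binary.PropositionalEquality.Properties using (setoid)
open import Relation.Nullary using (¬_; Dec; does; yes; no; contradiction)
open import Relation.Nullary.Decidable using (_×-dec_; _→-dec_)
open import Relation.Unary using (Decidable)
open import Relation.Unary.Properties using (∁?)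

private variable n : ℕ

x∈⋃⁺ : ∀ {x : Fin n} {ps} → Any (x ∈_) ps → x ∈ ⋃ ps
x∈⋃⁺ (here x∈p)   = x∈p∪q⁺ (inj₁ x∈p)
x∈⋃⁺ (there x∈ps) = x∈p∪q⁺ (inj₂ (x∈⋃⁺ x∈ps))

x∈⋃⁻ : ∀ {x : Fin n} ps → x ∈ ⋃ ps → Any (x ∈_) ps
x∈⋃⁻ []       x∈⊥ = contradiction x∈⊥ ∉⊥
x∈⋃⁻ (p ∷ ps) x∈  = [ here , there ∘ x∈⋃⁻ ps ]′ (x∈p∪q⁻ p (⋃ ps) x∈)

∣p∪q∣≡∣p─q∣+∣q∣ : ∀ (p q : Subset n) → ∣ p ∪ q ∣ ≡ ∣ p ─ q ∣ + ∣ q ∣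
∣p∪q∣≡∣p─q∣+∣q∣ []            []            = refl
∣p∪q∣≡∣p─q∣+∣q∣ (inside  ∷ p) (inside  ∷ q) = trans (cong suc (∣p∪q∣≡∣p─q∣+∣q∣ p q)) (sym (+-suc _ _))
∣p∪q∣≡∣p─q∣+∣q∣ (outside ∷ p) (inside  ∷ q) = trans (cong suc (∣p∪q∣≡∣p─q∣+∣q∣ p q)) (sym (+-suc _ _))
∣p∪q∣≡∣p─q∣+∣q∣ (inside  ∷ p) (outside ∷ q) = cong suc (∣p∪q∣≡∣p─q∣+∣q∣ p q)
∣p∪q∣≡∣p─q∣+∣q∣ (outside ∷ p) (outside ∷ q) = ∣p∪q∣≡∣p─q∣+∣q∣ p q

takeFirst : ℕ → Subset n → Subset n
takeFirst zero    p             = ⊥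
takeFirst (suc k) []            = []
takeFirst (suc k) (inside  ∷ p) = inside ∷ takeFirst k p
takeFirst (suc k) (outside ∷ p) = outside ∷ takeFirst (suc k) p

dropFirst : ℕ → Subset n → Subset n
dropFirst zero    p             = p
dropFirst (suc k) []            = []
dropFirst (suc k) (inside  ∷ p) = outside ∷ dropFirst k p
dropFirst (suc k) (outside ∷ p) = outside ∷ dropFirst (suc k) p

takeFirst-⊆ : ∀ k (p : Subset n) → takeFirst k p ⊆ p
takeFirst-⊆ zero    p             x∈         = contradiction x∈ ∉⊥
takeFirst-⊆ (suc k) (inside  ∷ p) here       = here
takeFirst-⊆ (suc k) (inside  ∷ p) (there x∈) = there (takeFirst-⊆ k p x∈)
takeFirst-⊆ (suc k) (outside ∷ p) (there x∈) = there (takeFirst-⊆ (suc k) p x∈)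

dropFirst-⊆ : ∀ k (p : Subset n) → dropFirst k p ⊆ p
dropFirst-⊆ zero    p             x∈         = x∈
dropFirst-⊆ (suc k) (inside  ∷ p) (there x∈) = there (dropFirst-⊆ k p x∈)
dropFirst-⊆ (suc k) (outside ∷ p) (there x∈) = there (dropFirst-⊆ (suc k) p x∈)

∣takeFirst∣≤k : ∀ k (p : Subset n) → ∣ takeFirst k p ∣ ≤ k
∣takeFirst∣≤k {n} zero p            = ≤-reflexive (∣⊥∣≡0 n)
∣takeFirst∣≤k (suc k) []            = z≤n
∣takeFirst∣≤k (suc k) (inside  ∷ p) = s≤s (∣takeFirst∣≤k k p)
∣takeFirst∣≤k (suc k) (outside ∷ p) = ∣takeFirst∣≤k (suc k) p

∣dropFirst∣≡∣p∣∸k : ∀ k (p : Subset n) → ∣ dropFirst k p ∣ ≡ ∣ p ∣ ∸ k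
∣dropFirst∣≡∣p∣∸k zero    p             = refl
∣dropFirst∣≡∣p∣∸k (suc k) []            = refl
∣dropFirst∣≡∣p∣∸k (suc k) (inside  ∷ p) = ∣dropFirst∣≡∣p∣∸k k p
∣dropFirst∣≡∣p∣∸k (suc k) (outside ∷ p) = ∣dropFirst∣≡∣p∣∸k (suc k) p

x∈takeFirst⊎x∈dropFirst : ∀ k (p : Subset n) {x} → x ∈ p → x ∈ takeFirst k p ⊎ x ∈ dropFirst k p
x∈takeFirst⊎x∈dropFirst zero    p             x∈         = inj₂ x∈
x∈takeFirst⊎x∈dropFirst (suc k) (inside  ∷ p) here       = inj₁ here
x∈takeFirst⊎x∈dropFirst (suc k) (inside  ∷ p) (there x∈) =
  Sum.map there there (x∈takeFirst⊎x∈dropFirst k p x∈)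
x∈takeFirst⊎x∈dropFirst (suc k) (outside ∷ p) (there x∈) =
  Sum.map there there (x∈takeFirst⊎x∈dropFirst (suc k) p x∈)

sum-map-∑ : ∀ {A : Set} {m} (f : A → Fin m → ℕ) xs →
            sum (map (λ x → ∑[ j < m ] f x j) xs) ≡ ∑[ j < m ] sum (map (λ x → f x j) xs)
sum-map-∑ {m = m} f []       = sym (sum-replicate-zero m)
sum-map-∑ {m = m} f (x ∷ xs) = trans (cong (_+_ (∑[ j < m ] f x j)) (sum-map-∑ f xs)) (sym (∑-distrib-+ (f x) _))

∑-bound : ∀ {m c} (f : Fin m → ℕ) → (∀ j → f j ≤ c) → ∑[ j < m ] f j ≤ m * c
∑-bound {zero}  f f≤c = z≤n
∑-bound {suc m} f f≤c = +-mono-≤ (f≤c _) (∑-bound (f ∘ Fin.suc) (f≤c ∘ Fin.suc))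

length*c≤sum : ∀ {A : Set} {c} (f : A → ℕ) {xs} → All (λ x → c ≤ f x) xs → length xs * c ≤ sum (map f xs)
length*c≤sum f []           = z≤n
length*c≤sum f (c≤fx ∷ c≤f) = +-mono-≤ c≤fx (length*c≤sum f c≤f)

length-filter+length-filter-∁ : ∀ {A : Set} {P : A → Set} (P? : Decidable P) xs →
                                length (filter P? xs) + length (filter (∁? P?) xs) ≡ length xs
length-filter+length-filter-∁ P? []       = refl
length-filter+length-filter-∁ P? (x ∷ xs) with does (P? x)
... | true  = cong suc (length-filter+length-filter-∁ P? xs)
... | false = trans (+-suc _ _) (cong suc (length-filter+length-filter-∁ P? xs))

All-mapWith∈ : ∀ {A B : Set} {P : B → Set} {xs : List A} (f : ∀ {x} → x ∈ₗ xs → B) →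
               (∀ {x} (x∈ : x ∈ₗ xs) → P (f x∈)) → All P (mapWith∈ xs f)
All-mapWith∈ {xs = []}     f Pf = []
All-mapWith∈ {xs = x ∷ xs} f Pf = Pf (here refl) ∷ All-mapWith∈ (f ∘ there) (Pf ∘ there)

AllPairs-mapWith∈ : ∀ {A B : Set} {R : A → A → Set} {S : B → B → Set} {xs : List A} (f : ∀ {x} → x ∈ₗ xs → B) →
                    (∀ {x y} (x∈ : x ∈ₗ xs) (y∈ : y ∈ₗ xs) → R x y → S (f x∈) (f y∈)) →
                    AllPairs R xs → AllPairs S (mapWith∈ xs f)
AllPairs-mapWith∈ f R⇒S []          = []
AllPairs-mapWith∈ f R⇒S (Rx ∷ Rxs) =
  All-mapWith∈ (f ∘ there) (λ y∈ → R⇒S (here refl) (there y∈) (All.lookup Rx y∈)) ∷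
  AllPairs-mapWith∈ (f ∘ there) (λ x∈ y∈ → R⇒S (there x∈) (there y∈)) Rxs

-- Sperner's theorem via the LYM inequality

-- s! (n − s)! is the number of maximal chains of subsets of [n] through a fixed s-set.
weight : ℕ → ℕ → ℕ
weight n s = s ! * (n ∸ s) !

weight≢0 : ∀ n s → NonZero (weight n s)
weight≢0 n s = s !* (n ∸ s) !≢0

nCk*weight≡n! : ∀ {n k} → k ≤ n → (n C k) * weight n k ≡ n !
nCk*weight≡n! {n} {k} k≤n = trans (cong (_* weight n k) (nCk≡n!/k![n-k]! k≤n)) (m/n*n≡m {{weight≢0 n k}} (k![n∸k]!∣n! k≤n))

weight≤n! : ∀ {n s} → s ≤ n → weight n s ≤ n !
weight≤n! {n} s≤n = ∣⇒≤ {{n !≢0}} (k![n∸k]!∣n! s≤n)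

weight-suc : ∀ {n s} → s ≤ n → weight (suc n) s ≡ (suc n ∸ s) * weight n s
weight-suc {n} {s} s≤n rewrite +-∸-assoc 1 s≤n = x∙yz≈y∙xz *-commutativeSemigroup (s !) (suc (n ∸ s)) ((n ∸ s) !)

weight-step : ∀ {n s} → s + suc s ≤ n → weight n (suc s) ≤ weight n s
weight-step {n} {s} 2s+1≤n rewrite +-∸-assoc 1 (m+n≤o⇒n≤o s 2s+1≤n) = begin
  suc s * s ! * x !     ≡⟨ *-assoc (suc s) (s !) (x !) ⟩
  suc s * (s ! * x !)   ≤⟨ *-monoˡ-≤ (s ! * x !) (s≤s (m+n≤o⇒m≤o∸n s 2s+1≤n)) ⟩
  suc x * (s ! * x !)   ≡⟨ x∙yz≈y∙xz *-commutativeSemigroup (suc x) (s !) (x !) ⟩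
  s ! * (suc x * x !)   ∎
  where
  open ≤-Reasoning
  x = n ∸ suc s

weight-antitone : ∀ {n s k} → s ≤′ k → k + k ≤ n → weight n k ≤ weight n s
weight-antitone ≤′-refl _ = ≤-refl
weight-antitone {k = suc k} (≤′-step s≤′k) 2k+2≤n =
  ≤-trans (weight-step (≤-trans (+-monoˡ-≤ (suc k) (n≤1+n k)) 2k+2≤n))
          (weight-antitone s≤′k (≤-trans (+-mono-≤ (n≤1+n k) (n≤1+n k)) 2k+2≤n))

Incomparable : Subset n → Subset n → Set
Incomparable p q = p ⊈ q × q ⊈ p

-- n! times the Lubell function Σ 1 / C(n, ∣p∣).
lubell : List (Subset n) → ℕ
lubell {n} ps = sum (map (λ p → weight n ∣ p ∣) ps)

restrict : Fin (suc n) → List (Subset (suc n)) → List (Subset n)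
restrict j []       = []
restrict j (p ∷ ps) with lookup p j
... | inside  = restrict j ps
... | outside = removeAt p j ∷ restrict j ps

∣removeAt∣ : ∀ (p : Subset (suc n)) j → lookup p j ≡ outside → ∣ removeAt p j ∣ ≡ ∣ p ∣
∣removeAt∣ (outside ∷ p)           Fin.zero    refl = refl
∣removeAt∣ (inside  ∷ p@(_ ∷ _))   (Fin.suc j) pj   = cong suc (∣removeAt∣ p j pj)
∣removeAt∣ (outside ∷ p@(_ ∷ _))   (Fin.suc j) pj   = ∣removeAt∣ p j pj

removeAt-⊆⁻ : ∀ {p q : Subset (suc n)} {j} → lookup p j ≡ outside → removeAt p j ⊆ removeAt q j → p ⊆ q
removeAt-⊆⁻ {p = p} {q} {j} pj p⊆q {x} x∈p =
  lookup⇒[]= x q (trans (sym (removeAt-punchOut q j≢x))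
    ([]=⇒lookup (p⊆q (lookup⇒[]= _ (removeAt p j) (trans (removeAt-punchOut p j≢x) ([]=⇒lookup x∈p))))))
  where
  j≢x : j ≢ x
  j≢x refl = contradiction (trans (sym pj) ([]=⇒lookup x∈p)) λ ()

restrict-All : ∀ {P : Subset (suc n) → Set} {Q : Subset n → Set} j →
               (∀ {q} → lookup q j ≡ outside → P q → Q (removeAt q j)) →
               ∀ {ps} → All P ps → All Q (restrict j ps)
restrict-All j P⇒Q []                  = []
restrict-All j P⇒Q {q ∷ _} (Pq ∷ Pps) with lookup q j in qj
... | inside  = restrict-All j P⇒Q Pps
... | outside = P⇒Q qj Pq ∷ restrict-All j P⇒Q Pps

restrict-AllPairs : ∀ j {ps : List (Subset (suc n))} →
                    AllPairs Incomparable ps → AllPairs Incomparable (restrict j ps)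
restrict-AllPairs j []                        = []
restrict-AllPairs j {p ∷ _} (p⋈ps ∷ ps⋈) with lookup p j in pj
... | inside  = restrict-AllPairs j ps⋈
... | outside = restrict-All j removeAt-incomparable p⋈ps ∷ restrict-AllPairs j ps⋈
  where
  removeAt-incomparable : ∀ {q} → lookup q j ≡ outside → Incomparable p q →
                          Incomparable (removeAt p j) (removeAt q j)
  removeAt-incomparable qj (p⊈q , q⊈p) = p⊈q ∘ removeAt-⊆⁻ pj , q⊈p ∘ removeAt-⊆⁻ qj

∑-outside : ∀ (p : Subset n) c → ∑[ j < n ] (if lookup p j then 0 else c) ≡ (n ∸ ∣ p ∣) * c
∑-outside []            c = refl
∑-outside (inside  ∷ p) c = ∑-outside p c
∑-outside (outside ∷ p) c = trans (cong (_+_ c) (∑-outside p c)) (cong (_* c) (sym (+-∸-assoc 1 (∣p∣≤n p))))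

sum-outside≡lubell-restrict : ∀ j (ps : List (Subset (suc n))) →
  sum (map (λ p → if lookup p j then 0 else weight n ∣ p ∣) ps) ≡ lubell (restrict j ps)
sum-outside≡lubell-restrict j []       = refl
sum-outside≡lubell-restrict j (p ∷ ps) with lookup p j in pj
... | inside  = sum-outside≡lubell-restrict j ps
... | outside = cong₂ _+_ (cong (weight _) (sym (∣removeAt∣ p j pj))) (sum-outside≡lubell-restrict j ps)

⊈⇒≢⊤ : ∀ {p q : Subset n} → p ⊈ q → q ≢ ⊤
⊈⇒≢⊤ p⊈q refl = p⊈q ⊆⊤

≢⊤⇒∣p∣≤n : ∀ {p : Subset (suc n)} → p ≢ ⊤ → ∣ p ∣ ≤ n
≢⊤⇒∣p∣≤n {p = p} p≢⊤ = ≤-pred (≤∧≢⇒< (∣p∣≤n p) (p≢⊤ ∘ ∣p∣≡n⇒p≡⊤))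

incomparable⇒≢⊤ : ∀ {p q : Subset n} {ps} → AllPairs Incomparable (p ∷ q ∷ ps) → All (_≢ ⊤) (p ∷ q ∷ ps)
incomparable⇒≢⊤ (p⋈qps@((_ , q⊈p) ∷ _) ∷ _) = ⊈⇒≢⊤ q⊈p ∷ All.map (⊈⇒≢⊤ ∘ proj₁) p⋈qps

lym : ∀ n (ps : List (Subset n)) → AllPairs Incomparable ps → lubell ps ≤ n !
lym n       []           _ = z≤n
lym n       (p ∷ [])     _ = ≤-trans (≤-reflexive (+-identityʳ _)) (weight≤n! (∣p∣≤n p))
lym zero    ([] ∷ [] ∷ _) (((p⊈q , _) ∷ _) ∷ _) = ⊥-elim (p⊈q ⊆-refl)
-- Double counting: weight (1 + n) ∣p∣ = (1 + n − ∣p∣) · weight n ∣p∣, and exactly 1 + n − ∣p∣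
-- coordinates j avoid p.
lym (suc n) ps@(_ ∷ _ ∷ _) ps⋈ = begin
  lubell ps
    ≡⟨ cong sum (map-cong-local (All.map outsideCount (incomparable⇒≢⊤ ps⋈))) ⟩
  sum (map (λ p → ∑[ j < suc n ] outsideWeight j p) ps)
    ≡⟨ sum-map-∑ (λ p j → outsideWeight j p) ps ⟩
  ∑[ j < suc n ] sum (map (outsideWeight j) ps)
    ≡⟨ sum-cong-≗ (λ j → sum-outside≡lubell-restrict j ps) ⟩
  ∑[ j < suc n ] lubell (restrict j ps)
    ≤⟨ ∑-bound _ (λ j → lym n (restrict j ps) (restrict-AllPairs j ps⋈)) ⟩
  suc n * n ! ∎
  where
  open ≤-Reasoning
  outsideWeight : Fin (suc n) → Subset (suc n) → ℕ
  outsideWeight j p = if lookup p j then 0 else weight n ∣ p ∣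
  outsideCount : ∀ {p} → p ≢ ⊤ → weight (suc n) ∣ p ∣ ≡ ∑[ j < suc n ] outsideWeight j p
  outsideCount {p} p≢⊤ = trans (weight-suc (≢⊤⇒∣p∣≤n p≢⊤)) (sym (∑-outside p (weight n ∣ p ∣)))

sperner : ∀ {n k} → k + k ≤ n → {ps : List (Subset n)} → AllPairs Incomparable ps →
          All (λ p → ∣ p ∣ ≤ k) ps → length ps ≤ n C k
sperner {n} {k} 2k≤n {ps} ps⋈ small = *-cancelʳ-≤ (length ps) (n C k) (weight n k) {{weight≢0 n k}} (begin
  length ps * weight n k ≤⟨ length*c≤sum _ (All.map (λ ∣p∣≤k → weight-antitone (≤⇒≤′ ∣p∣≤k) 2k≤n) small) ⟩
  lubell ps              ≤⟨ lym n ps ps⋈ ⟩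
  n !                    ≡⟨ nCk*weight≡n! (m+n≤o⇒m≤o k 2k≤n) ⟨
  (n C k) * weight n k   ∎)
  where open ≤-Reasoning

-- Cover-free families

Other : List (Subset n) → Subset n → Subset n → Set
Other F G H = H ∈ₗ F × H ≢ G

CoverFree : ℕ → List (Subset n) → Set
CoverFree r F = ∀ {G} → G ∈ₗ F → ∀ Y → All (Other F G) Y → length Y ≤ r → G ⊈ ⋃ Y

OwnedBy : List (Subset n) → Subset n → Subset n → Set
OwnedBy F G P = All (λ H → P ⊆ H → H ≡ G) F

HasOwnSubset : ℕ → List (Subset n) → Subset n → Set
HasOwnSubset k F G = ∃ λ P → P ⊆ G × ∣ P ∣ ≤ k × OwnedBy F G P

SubsetsShared : ℕ → List (Subset n) → Subset n → Set
SubsetsShared k F G = ∀ P → P ⊆ G → ∣ P ∣ ≤ k → ∃ λ H → Other F G H × P ⊆ H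

owns? : ∀ (G P H : Subset n) → Dec (P ⊆ H → H ≡ G)
owns? G P H = P ⊆? H →-dec ≡-dec _≟ᵇ_ H G

hasOwnSubset? : ∀ k (F : List (Subset n)) → Decidable (HasOwnSubset k F)
hasOwnSubset? k F G = anySubset? λ P → P ⊆? G ×-dec ∣ P ∣ ≤? k ×-dec All.all? (owns? G P) F

¬hasOwnSubset⇒subsetsShared : ∀ {k F} {G : Subset n} → ¬ HasOwnSubset k F G → SubsetsShared k F G
¬hasOwnSubset⇒subsetsShared {F = F} {G} ¬own P P⊆G ∣P∣≤k with All.all? (owns? G P) F
... | yes owned = contradiction (P , (λ {_} → P⊆G) , ∣P∣≤k , owned) ¬own
... | no ¬owned with find (Allₚ.¬All⇒Any¬ (owns? G P) F ¬owned)
...   | H , H∈F , ¬[P⊆H⇒H≡G] with P ⊆? H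
...     | yes P⊆H = H , (H∈F , λ H≡G → ¬[P⊆H⇒H≡G] λ _ → H≡G) , (λ {_} → P⊆H)
...     | no  P⊈H = contradiction (λ P⊆H → contradiction P⊆H P⊈H) ¬[P⊆H⇒H≡G]

subsetsShared⇒covered : ∀ {k F} {G : Subset n} → SubsetsShared k F G → ∀ q {W} → W ⊆ G → ∣ W ∣ ≤ q * k →
                        ∃ λ Y → length Y ≤ q × All (Other F G) Y × W ⊆ ⋃ Y
subsetsShared⇒covered shared zero {W} _ ∣W∣≤0 =
  [] , z≤n , [] , λ x∈W → contradiction (≤-trans (x∈p⇒∣p-x∣<∣p∣ x∈W) ∣W∣≤0) λ ()
subsetsShared⇒covered {k = k} shared (suc q) {W} W⊆G ∣W∣≤[1+q]k
  with shared (takeFirst k W) (⊆-trans (takeFirst-⊆ k W) W⊆G) (∣takeFirst∣≤k k W)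
     | subsetsShared⇒covered shared q (⊆-trans (dropFirst-⊆ k W) W⊆G) ∣drop∣≤qk
  where
  ∣drop∣≤qk : ∣ dropFirst k W ∣ ≤ q * k
  ∣drop∣≤qk = begin
    ∣ dropFirst k W ∣  ≡⟨ ∣dropFirst∣≡∣p∣∸k k W ⟩
    ∣ W ∣ ∸ k          ≤⟨ ∸-monoˡ-≤ k ∣W∣≤[1+q]k ⟩
    k + q * k ∸ k      ≡⟨ m+n∸m≡n k (q * k) ⟩
    q * k              ∎
    where open ≤-Reasoning
... | H , H-other , take⊆H | Y , ∣Y∣≤q , Y-others , drop⊆⋃Y =
  H ∷ Y , s≤s ∣Y∣≤q , H-other ∷ Y-others ,
  λ x∈W → x∈p∪q⁺ (Sum.map take⊆H drop⊆⋃Y (x∈takeFirst⊎x∈dropFirst k W x∈W))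

-- Σ_{i<m} (i·k + 1); m members owning no subset of size ≤ k cover at least this many points.
spread : ℕ → ℕ → ℕ
spread k m = (m C 2) * k + m

spread-suc : ∀ k m → spread k (suc m) ≡ suc (m * k) + spread k m
spread-suc k m = begin
  (suc m C 2) * k + suc m     ≡⟨ cong (λ c → c * k + suc m) (nCk+nC[k+1]≡[n+1]C[k+1] m 1) ⟨
  (m C 1 + m C 2) * k + suc m ≡⟨ cong (λ c → (c + m C 2) * k + suc m) (nC1≡n m) ⟩
  (m + m C 2) * k + suc m     ≡⟨ solve 3 (λ m c k → (m :+ c) :* k :+ (con 1 :+ m) := (con 1 :+ m :* k) :+ (c :* k :+ m))
                                         refl m (m C 2) k ⟩
  suc (m * k) + spread k m    ∎
  where
  open ≡-Reasoning
  open +-*-Solver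

module _ {n k r : ℕ} {F : List (Subset n)} (coverFree : CoverFree r F) where

  -- Otherwise B ─ ⋃ Bs is covered by m more members, one for each k of its points.
  shared⇒outsideUnion : ∀ {B Bs m} → B ∈ₗ F → SubsetsShared k F B → All (Other F B) Bs →
                        length Bs + m ≤ r → m * k < ∣ B ─ ⋃ Bs ∣
  shared⇒outsideUnion {B} {Bs} {m} B∈F shared Bs-others len with m * k <? ∣ B ─ ⋃ Bs ∣
  ... | yes mk<∣B─U∣ = mk<∣B─U∣
  ... | no  mk≮∣B─U∣ with subsetsShared⇒covered shared m (p─q⊆p B (⋃ Bs)) (≮⇒≥ mk≮∣B─U∣)
  ...   | Y , ∣Y∣≤m , Y-others , B─U⊆⋃Y =
    ⊥-elim (coverFree B∈F (Bs ++ Y) (Allₚ.++⁺ Bs-others Y-others) ∣Bs++Y∣≤r B⊆⋃[Bs++Y])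
    where
    ∣Bs++Y∣≤r : length (Bs ++ Y) ≤ r
    ∣Bs++Y∣≤r = ≤-trans (≤-reflexive (length-++ Bs)) (≤-trans (+-monoʳ-≤ (length Bs) ∣Y∣≤m) len)
    B⊆⋃[Bs++Y] : B ⊆ ⋃ (Bs ++ Y)
    B⊆⋃[Bs++Y] {x} x∈B with x ∈? ⋃ Bs
    ... | yes x∈U = x∈⋃⁺ (Anyₚ.++⁺ˡ (x∈⋃⁻ Bs x∈U))
    ... | no  x∉U = x∈⋃⁺ (Anyₚ.++⁺ʳ Bs (x∈⋃⁻ Y (B─U⊆⋃Y (x∈p∧x∉q⇒x∈p─q x∈B x∉U))))

  SharedMember : Subset n → Set
  SharedMember B = B ∈ₗ F × SubsetsShared k F B

  spread≤∣⋃∣+spread : ∀ {Bs} → Unique Bs → All SharedMember Bs → ∀ m → length Bs + m ≤ suc r →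
                      spread k (length Bs + m) ≤ ∣ ⋃ Bs ∣ + spread k m
  spread≤∣⋃∣+spread {[]} _ _ m _ = ≤-reflexive (cong (_+ spread k m) (sym (∣⊥∣≡0 n)))
  spread≤∣⋃∣+spread {B ∷ Bs} (B∉Bs ∷ Bs-unique) ((B∈F , shared) ∷ Bs-shared) m len = begin
    spread k (suc (length Bs) + m)       ≡⟨ cong (spread k) (+-suc (length Bs) m) ⟨
    spread k (length Bs + suc m)         ≤⟨ spread≤∣⋃∣+spread Bs-unique Bs-shared (suc m) len′ ⟩
    ∣ U ∣ + spread k (suc m)             ≡⟨ cong (_+_ ∣ U ∣) (spread-suc k m) ⟩
    ∣ U ∣ + (suc (m * k) + spread k m)   ≡⟨ x∙yz≈yx∙z +-commutativeSemigroup ∣ U ∣ (suc (m * k)) (spread k m) ⟩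
    (suc (m * k) + ∣ U ∣) + spread k m   ≤⟨ +-monoˡ-≤ (spread k m) (+-monoˡ-≤ ∣ U ∣ mk<∣B─U∣) ⟩
    (∣ B ─ U ∣ + ∣ U ∣) + spread k m     ≡⟨ cong (_+ spread k m) (∣p∪q∣≡∣p─q∣+∣q∣ B U) ⟨
    ∣ B ∪ U ∣ + spread k m               ∎
    where
    open ≤-Reasoning
    U = ⋃ Bs
    len′ : length Bs + suc m ≤ suc r
    len′ = ≤-trans (≤-reflexive (+-suc (length Bs) m)) len
    Bs-others : All (Other F B) Bs
    Bs-others = All.zipWith (λ (B≢B′ , B′∈F , _) → B′∈F , B≢B′ ∘ sym) (B∉Bs , Bs-shared)
    mk<∣B─U∣ : m * k < ∣ B ─ U ∣
    mk<∣B─U∣ = shared⇒outsideUnion B∈F shared Bs-others (≤-pred len)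

  sharedMembers-bound : n < spread k (suc r) → ∀ {Bs} → Unique Bs → All SharedMember Bs → length Bs ≤ r
  sharedMembers-bound n<spread {Bs} Bs-unique Bs-shared with length Bs ≤? r
  ... | yes ∣Bs∣≤r = ∣Bs∣≤r
  ... | no  ∣Bs∣≰r = contradiction spread≤n (<⇒≱ n<spread)
    where
    first = take (suc r) Bs
    ∣first∣≡1+r : length first + 0 ≡ suc r
    ∣first∣≡1+r = trans (+-identityʳ _) (trans (length-take (suc r) Bs) (m≤n⇒m⊓n≡m (≰⇒> ∣Bs∣≰r)))
    spread≤n : spread k (suc r) ≤ n
    spread≤n = begin
      spread k (suc r)             ≡⟨ cong (spread k) ∣first∣≡1+r ⟨
      spread k (length first + 0)  ≤⟨ spread≤∣⋃∣+spread (Uniqueₚ.take⁺ (suc r) Bs-unique)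
                                        (Allₚ.take⁺ (suc r) Bs-shared) 0 (≤-reflexive ∣first∣≡1+r) ⟩
      ∣ ⋃ first ∣ + 0              ≤⟨ ≤-reflexive (+-identityʳ _) ⟩
      ∣ ⋃ first ∣                  ≤⟨ ∣p∣≤n (⋃ first) ⟩
      n                            ∎
      where open ≤-Reasoning

ownSubsets-bound : ∀ {k} {F : List (Subset n)} → k + k ≤ n → ∀ {Gs} → Unique Gs →
                   All (λ G → G ∈ₗ F × HasOwnSubset k F G) Gs → length Gs ≤ n C k
ownSubsets-bound {n} {k} {F} 2k≤n {Gs} Gs-unique Gs-own = begin
  length Gs  ≡⟨ length-mapWith∈ (setoid (Subset n)) Gs ⟨
  length Ps  ≤⟨ sperner 2k≤n Ps-incomparable (All-mapWith∈ ownSubset (proj₁ ∘ proj₂ ∘ proj₂ ∘ own)) ⟩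
  n C k      ∎
  where
  open ≤-Reasoning
  own : ∀ {G} → G ∈ₗ Gs → HasOwnSubset k F G
  own G∈ = proj₂ (All.lookup Gs-own G∈)
  ownSubset : ∀ {G} → G ∈ₗ Gs → Subset n
  ownSubset G∈ = proj₁ (own G∈)
  Ps = mapWith∈ Gs ownSubset
  owned⇒⊈ : ∀ {G G′} (G∈ : G ∈ₗ Gs) (G′∈ : G′ ∈ₗ Gs) → G ≢ G′ → ownSubset G∈ ⊈ ownSubset G′∈
  owned⇒⊈ G∈ G′∈ G≢G′ P⊆P′ with own G∈ | own G′∈
  ... | P , _ , _ , P-owned | P′ , P′⊆G′ , _ , _ =
    G≢G′ (sym (All.lookup P-owned (proj₁ (All.lookup Gs-own G′∈)) (⊆-trans P⊆P′ P′⊆G′)))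
  Ps-incomparable : AllPairs Incomparable Ps
  Ps-incomparable = AllPairs-mapWith∈ ownSubset
    (λ G∈ G′∈ G≢G′ → owned⇒⊈ G∈ G′∈ G≢G′ , owned⇒⊈ G′∈ G∈ (G≢G′ ∘ sym)) Gs-unique

coverFree-bound : ∀ {k r} {F : List (Subset n)} → CoverFree r F → Unique F →
                  n < spread k (suc r) → k + k ≤ n → length F ≤ n C k + r
coverFree-bound {n} {k} {r} {F} coverFree F-unique n<spread 2k≤n = begin
  length F                       ≡⟨ length-filter+length-filter-∁ own? F ⟨
  length owners + length sharers ≤⟨ +-mono-≤ owners-bound sharers-bound ⟩
  n C k + r                      ∎
  where
  open ≤-Reasoning
  own? = hasOwnSubset? k F
  owners = filter own? F
  sharers = filter (∁? own?) F
  owners-bound : length owners ≤ n C k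
  owners-bound = ownSubsets-bound 2k≤n (Uniqueₚ.filter⁺ own? F-unique) (All.tabulate (∈-filter⁻ own?))
  sharers-bound : length sharers ≤ r
  sharers-bound = sharedMembers-bound coverFree n<spread (Uniqueₚ.filter⁺ (∁? own?) F-unique)
    (All.tabulate λ B∈ → let B∈F , ¬own = ∈-filter⁻ (∁? own?) B∈ in B∈F , ¬hasOwnSubset⇒subsetsShared ¬own)

-- Frameproof codes as cover-free families

-- Words are subsets (Side = Bool); c Δ x is the set of coordinates where c and x differ.
_Δ_ : Subset n → Subset n → Subset n
_Δ_ = zipWith _xor_

Δ-cancelˡ : ∀ (p q : Subset n) → p Δ (p Δ q) ≡ q
Δ-cancelˡ []          []      = refl
Δ-cancelˡ (true  ∷ p) (b ∷ q) = cong₂ _∷_ (not-involutive b) (Δ-cancelˡ p q)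
Δ-cancelˡ (false ∷ p) (b ∷ q) = cong (b ∷_) (Δ-cancelˡ p q)

Δ-injectiveʳ : ∀ (p : Subset n) {q q′} → p Δ q ≡ p Δ q′ → q ≡ q′
Δ-injectiveʳ p {q} {q′} eq = trans (sym (Δ-cancelˡ p q)) (trans (cong (p Δ_) eq) (Δ-cancelˡ p q′))

≢⇒∈Δ : ∀ (p q : Subset n) {i} → lookup p i ≢ lookup q i → i ∈ p Δ q
≢⇒∈Δ p q {i} pᵢ≢qᵢ = lookup⇒[]= i (p Δ q) (begin
  lookup (p Δ q) i               ≡⟨ lookup-zipWith _xor_ i p q ⟩
  lookup p i xor lookup q i      ≡⟨ cong (_xor lookup q i) (¬-not pᵢ≢qᵢ) ⟩
  not (lookup q i) xor lookup q i ≡⟨ xor-inverseˡ (lookup q i) ⟩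
  true                           ∎)
  where open ≡-Reasoning

∈⇒lookup-Δ : ∀ (p q : Subset n) {i} → i ∈ q → lookup (p Δ q) i ≡ not (lookup p i)
∈⇒lookup-Δ p q {i} i∈q =
  trans (lookup-zipWith _xor_ i p q) (trans (cong (lookup p i xor_) ([]=⇒lookup i∈q)) (xor-comm (lookup p i) true))

module _ {n : ℕ} {c : Word n} {cs : List (Word n)} (unique : Unique (c ∷ cs)) where

  Δ-unique : Unique (map (c Δ_) cs)
  Δ-unique = Uniqueₚ.map⁺ (Δ-injectiveʳ c) (AllPairs.tail unique)

  frameproof⇒coverFree : ∀ {r} → IsFrameproof (suc r) (c ∷ cs) → CoverFree r (map (c Δ_) cs)
  frameproof⇒coverFree {r} frameproof G∈F Y Y-others ∣Y∣≤r G⊆⋃Y with ∈-map⁻ (c Δ_) G∈F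
  ... | x , x∈cs , refl = x∉X (frameproof X X⊆c∷cs (s≤s z≤n) ∣X∣≤1+r x (there x∈cs) x∈descX)
    where
    X = c ∷ map (c Δ_) Y
    X⊆c∷cs : ∀ {z} → z ∈ₗ X → z ∈ₗ c ∷ cs
    X⊆c∷cs (here refl) = here refl
    X⊆c∷cs (there z∈) with ∈-map⁻ (c Δ_) z∈
    ... | H , H∈Y , refl with ∈-map⁻ (c Δ_) (proj₁ (All.lookup Y-others H∈Y))
    ...   | y , y∈cs , refl = there (subst (_∈ₗ cs) (sym (Δ-cancelˡ c y)) y∈cs)
    ∣X∣≤1+r : length X ≤ suc r
    ∣X∣≤1+r = s≤s (≤-trans (≤-reflexive (length-map (c Δ_) Y)) ∣Y∣≤r)
    x∈descX : x ∈desc X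
    x∈descX i with lookup c i ≟ᵇ lookup x i
    ... | yes cᵢ≡xᵢ = c , here refl , sym cᵢ≡xᵢ
    ... | no  cᵢ≢xᵢ with find (x∈⋃⁻ Y (G⊆⋃Y (≢⇒∈Δ c x cᵢ≢xᵢ)))
    ...   | H , H∈Y , i∈H = c Δ H , there (∈-map⁺ (c Δ_) H∈Y) ,
                            trans (¬-not (cᵢ≢xᵢ ∘ sym)) (sym (∈⇒lookup-Δ c H i∈H))
    x∉X : ¬ x ∈ₗ X
    x∉X (here x≡c) = All.lookup (AllPairs.head unique) x∈cs (sym x≡c)
    x∉X (there x∈) with ∈-map⁻ (c Δ_) x∈
    ... | H , H∈Y , refl = proj₂ (All.lookup Y-others H∈Y) (sym (Δ-cancelˡ c H))

-- The choice of k

n≤nC2 : ∀ {n} → 3 ≤ n → n ≤ n C 2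
n≤nC2 (s≤s (s≤s (s≤s (z≤n {zero})))) = ≤-refl
n≤nC2 {suc m} (s≤s (s≤s (s≤s (z≤n {suc k})))) = begin
  suc m         ≡⟨ +-comm 1 m ⟩
  m + 1         ≤⟨ +-monoʳ-≤ m (≤-trans (s≤s z≤n) (n≤nC2 (s≤s (s≤s (s≤s (z≤n {k})))))) ⟩
  m + m C 2     ≡⟨ cong (_+ m C 2) (nC1≡n m) ⟨
  m C 1 + m C 2 ≡⟨ nCk+nC[k+1]≡[n+1]C[k+1] m 1 ⟩
  suc m C 2     ∎
  where open ≤-Reasoning

d≤[d+b]/[1+b]*[1+b] : ∀ d b → d ≤ ((d + b) / suc b) * suc b
d≤[d+b]/[1+b]*[1+b] d b = +-cancelʳ-≤ b d (k * suc b) (begin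
  d + b                       ≡⟨ m≡m%n+[m/n]*n (d + b) (suc b) ⟩
  (d + b) % suc b + k * suc b ≤⟨ +-monoˡ-≤ (k * suc b) (≤-pred (m%n<n (d + b) (suc b))) ⟩
  b + k * suc b               ≡⟨ +-comm b (k * suc b) ⟩
  k * suc b + b               ∎)
  where
  open ≤-Reasoning
  k = (d + b) / suc b

k+k≤1+d : ∀ {d b k} → 1 ≤ b → k * suc b ≤ d + b → k + k ≤ suc d
k+k≤1+d {k = zero}      _   _              = z≤n
k+k≤1+d {d} {b} {suc k} 1≤b [1+k][1+b]≤d+b = s≤s (begin
  k + suc k       ≡⟨ +-suc k k ⟩
  suc (k + k)     ≤⟨ s≤s (+-monoʳ-≤ k (m≤m*n k b {{>-nonZero 1≤b}})) ⟩
  suc (k + k * b) ≡⟨ cong suc (*-suc k b) ⟨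
  suc (k * suc b) ≤⟨ +-cancelˡ-≤ b (suc (k * suc b)) d b+1+k[1+b]≤b+d ⟩
  d               ∎)
  where
  open ≤-Reasoning
  b+1+k[1+b]≤b+d : b + suc (k * suc b) ≤ b + d
  b+1+k[1+b]≤b+d = ≤-trans (≤-reflexive (+-suc b (k * suc b))) (≤-trans [1+k][1+b]≤d+b (≤-reflexive (+-comm d b)))

ceilDiv-neg : ∀ {a b} → suc a < suc b → ceilDiv -[1+ a ] (suc b) ≡ + 0
ceilDiv-neg {a} {b} a<b rewrite m<n⇒m/n≡0 {suc a} {suc b} a<b = refl

n-t+1≡1+n⊖t : ∀ n t → (+ n - + t) +ℤ + 1 ≡ suc n ⊖ t
n-t+1≡1+n⊖t n t = trans (cong (_+ℤ + 1) ([+m]-[+n]≡m⊖n n t))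
                        (trans (distribˡ-⊖-+-pos 1 n t) (cong (_⊖ t) (+-comm n 1)))

ceilDiv-bounds : ∀ n t b → 2 ≤ t → t ≤ b →
                 ∃ λ k → ceilDiv ((+ n - + t) +ℤ + 1) b ≡ + k × n < b * k + t × k + k ≤ n
ceilDiv-bounds _ _ zero    (s≤s _) ()
ceilDiv-bounds n t (suc b) 2≤t t≤1+b with t ≤? suc n
... | yes t≤1+n = k , ceilDiv≡k , n<[1+b]k+t , k+k≤n
  where
  d = suc n ∸ t
  k = (d + b) / suc b
  ceilDiv≡k : ceilDiv ((+ n - + t) +ℤ + 1) (suc b) ≡ + k
  ceilDiv≡k = cong (λ z → ceilDiv z (suc b)) (trans (n-t+1≡1+n⊖t n t) (⊖-≥ t≤1+n))
  n<[1+b]k+t : n < suc b * k + t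
  n<[1+b]k+t = begin-strict
    n             <⟨ n<1+n n ⟩
    suc n         ≡⟨ m∸n+n≡m t≤1+n ⟨
    d + t         ≤⟨ +-monoˡ-≤ t (d≤[d+b]/[1+b]*[1+b] d b) ⟩
    k * suc b + t ≡⟨ cong (_+ t) (*-comm k (suc b)) ⟩
    suc b * k + t ∎
    where open ≤-Reasoning
  k+k≤n : k + k ≤ n
  k+k≤n = begin
    k + k           ≤⟨ k+k≤1+d {k = k} (≤-pred (≤-trans 2≤t t≤1+b)) (m/n*n≤m (d + b) (suc b)) ⟩
    suc d           ≡⟨ +-∸-assoc 1 t≤1+n ⟨
    suc (suc n) ∸ t ≤⟨ ∸-monoʳ-≤ (suc (suc n)) 2≤t ⟩
    n               ∎
    where open ≤-Reasoning
... | no t≰1+n = 0 , ceilDiv≡0 , n<[1+b]0+t , z≤n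
  where
  1+n<t : suc n < t
  1+n<t = ≰⇒> t≰1+n
  ceilDiv≡0 : ceilDiv ((+ n - + t) +ℤ + 1) (suc b) ≡ + 0
  ceilDiv≡0 = trans
    (cong (λ z → ceilDiv z (suc b))
          (trans (n-t+1≡1+n⊖t n t) (trans (⊖-< 1+n<t) (cong (λ m → - (+ m)) (+-∸-assoc 1 1+n<t)))))
    (ceilDiv-neg (≤-trans (subst (_< t) (+-∸-assoc 1 1+n<t) (∸-monoʳ-< (s≤s z≤n) (<⇒≤ 1+n<t))) t≤1+b))
  n<[1+b]0+t : n < suc b * 0 + t
  n<[1+b]0+t = subst (n <_) (cong (_+ t) (sym (*-zeroʳ (suc b)))) (<-trans (n<1+n n) 1+n<t)

corollary1p9 : (t n : ℕ) → 3 ≤ t → (𝒞 : List (Word n)) → Unique 𝒞 → IsFrameproof t 𝒞 →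
    length 𝒞 ≤ binomℤ n (ceilDiv ((+ n - + t) +ℤ + 1) (t C 2)) + t
corollary1p9 t       n _   []      _      _          = z≤n
corollary1p9 (suc r) n 3≤t (c ∷ cs) unique frameproof
  with k , ceilDiv≡k , n<spread , 2k≤n ← ceilDiv-bounds n (suc r) (suc r C 2) (≤-trans (s≤s (s≤s z≤n)) 3≤t) (n≤nC2 3≤t)
  rewrite ceilDiv≡k = begin
    suc (length cs)              ≡⟨ cong suc (length-map (c Δ_) cs) ⟨
    suc (length (map (c Δ_) cs)) ≤⟨ s≤s (coverFree-bound coverFree (Δ-unique unique) n<spread 2k≤n) ⟩
    suc (n C k + r)              ≡⟨ +-suc (n C k) r ⟨
    n C k + suc r                ∎
  where
  open ≤-Reasoning
  coverFree : CoverFree r (map (c Δ_) cs)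
  coverFree = frameproof⇒coverFree unique frameproof
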